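{- Let $G$ be a connected proper interval graph and let $v_1,v_2,\dots,v_n$ be a straight enumeration of $G$. Suppose that $v_\alpha$ is a cut-vertex of the complement $\overline{G}$. Then $\alpha\in\{1,n\}$ and $G-v_\alpha$ contains a vertex that is adjacent in $G$ to every vertex of $G$ except $v_\alpha$.
   Context: A proper interval graph is the intersection graph of a family of intervals on a line, none containing another. A straight enumeration of $G$ is an ordering $v_1,\dots,v_n$ of $V(G)$ such that whenever $i<j<k$ and $v_iv_k\in E(G)$, both $v_iv_j$ and $v_jv_k$ are edges. A cut-vertex of a graph is a vertex whose deletion increases the number of components. -}

module Defs where

open import Data.Nat using (ℕ)
open import Data.Fin using (Fin; _<_; toℕ)
open import Data.Rational using (ℚ; _≤_)
open import Data.Product using (Σ; _×_; ∃; ∃-syntax)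
open import Relation.Nullary using (¬_; Dec)
open import Relation.Binary.PropositionalEquality using (_≡_; _≢_)
open import Function.Bundles using (_↔_)

record Graph (n : ℕ) : Set₁ where
  field
    Adj     : Fin n → Fin n → Set
    adj?    : ∀ u v → Dec (Adj u v)
    sym     : ∀ {u v} → Adj u v → Adj v u
    irrefl  : ∀ {u} → ¬ Adj u u
open Graph public

complement : ∀ {n} → Graph n → Graph n
complement {n} G = record
  { Adj    = λ u v → (u ≢ v) × ¬ Adj G u v
  ; adj?   = dec
  ; sym    = λ { (u≢v , ¬a) → (λ e → u≢v (Eq.sym e)) , (λ a → ¬a (Graph.sym G a)) }
  ; irrefl = λ { (u≢u , _) → u≢u Eq.refl }
  }
  where
  import Relation.Binary.PropositionalEquality as Eq
  open import Relation.Nullary using (yes; no)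
  open import Data.Product using (_,_)
  open import Data.Fin using (_≟_)
  dec : ∀ u v → Dec ((u ≢ v) × ¬ Adj G u v)
  dec u v with u ≟ v | adj? G u v
  ... | yes e | _     = no λ { (u≢v , _) → u≢v e }
  ... | no ne | yes a = no λ { (_ , ¬a) → ¬a a }
  ... | no ne | no na = yes (ne , na)

-- Walks in G using only vertices satisfying S (i.e. in the induced subgraph G[S]).
data WalkIn {n} (G : Graph n) (S : Fin n → Set) : Fin n → Fin n → Set where
  here : ∀ {u} → S u → WalkIn G S u u
  step : ∀ {u v w} → S u → Adj G u v → WalkIn G S v w → WalkIn G S u w

Reachable : ∀ {n} → Graph n → Fin n → Fin n → Set
Reachable G = WalkIn G (λ _ → Data.Unit.⊤)
  where import Data.Unit

ReachableAvoiding : ∀ {n} → Graph n → Fin n → Fin n → Fin n → Set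
ReachableAvoiding G x = WalkIn G (λ w → w ≢ x)

Connected : ∀ {n} → Graph n → Set
Connected G = ∀ u v → Reachable G u v

-- x is a cut-vertex of G: deleting x increases the number of components,
-- i.e. some two vertices other than x lying in the same component of G
-- are in different components of G - x.
IsCutVertex : ∀ {n} → Graph n → Fin n → Set
IsCutVertex {n} G x =
  ∃[ u ] ∃[ v ] (u ≢ x × v ≢ x × Reachable G u v × ¬ ReachableAvoiding G x u v)

record Interval : Set where
  field
    left  : ℚ
    right : ℚ
    l≤r   : left ≤ right
open Interval public

Intersect : Interval → Interval → Set
Intersect I J = (left I ≤ right J) × (left J ≤ right I)

Contains : Interval → Interval → Set
Contains I J = (left I ≤ left J) × (right J ≤ right I)

IsProperInterval : ∀ {n} → Graph n → Set
IsProperInterval {n} G =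
  Σ (Fin n → Interval) λ I →
    (∀ u v → u ≢ v → (Adj G u v → Intersect (I u) (I v)) × (Intersect (I u) (I v) → Adj G u v))
    × (∀ u v → u ≢ v → ¬ Contains (I u) (I v))

-- A straight enumeration: a bijection e : Fin n ↔ V(G), e i = v_(i+1).
IsStraightEnumeration : ∀ {n} → Graph n → (Fin n ↔ Fin n) → Set
IsStraightEnumeration {n} G e =
  ∀ (i j k : Fin n) → i < j → j < k → Adj G (f i) (f k) →
    Adj G (f i) (f j) × Adj G (f j) (f k)
  where f = Function.Bundles.Inverse.to e
        import Function.Bundles

{-# OPTIONS --safe #-}
-- Only the straight enumeration matters. In it, non-adjacency spreads outwards:
-- v_i ≁ v_j with i < j gives v_i ≁ v_k for every k ≥ j, and symmetrically.
-- If 1 < α < n, every complement-neighbour of v_α left of α is a complement-neighbour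
-- of v_n, every one right of α one of v_1, and two on opposite sides are adjacent
-- in the complement, so deleting v_α separates nothing. If no vertex other than v_α
-- is adjacent to all the others, then the first and the last vertex p, q of G - v_α
-- are adjacent in the complement, and every other vertex is adjacent there to p or
-- to q, so the complement of G - v_α is connected.
module Submission where

open import Defs
open import Data.Nat using (suc; z≤n; s≤s)
import Data.Nat.Properties as ℕ
open import Data.Fin using (Fin; toℕ; zero; suc; fromℕ; _<_; _≤_; _≟_)
open import Data.Fin.Properties
  using (toℕ-fromℕ; ≤fromℕ; <-cmp; <⇒≢; ≤∧≢⇒<; ≤-antisym; ¬∀⟶∃¬; any?; all?)
open import Data.Product using (_×_; ∃-syntax; _,_; proj₁; proj₂)
open import Data.Sum using (_⊎_; inj₁; inj₂)
open import Data.Empty using (⊥; ⊥-elim)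
open import Data.Unit using (tt)
open import Function using (_∘_)
open import Function.Bundles using (_↔_; Inverse; Injection)
open import Function.Properties.Inverse using (↔⇒↣; ↔-sym)
open import Relation.Nullary using (¬_; Dec; yes; no)
open import Relation.Nullary.Decidable using (¬?; _×-dec_; _→-dec_)
open import Relation.Binary using (tri<; tri≈; tri>)
open import Relation.Binary.PropositionalEquality
  using (_≡_; _≢_; refl; cong; subst; subst₂; ≢-sym)
import Relation.Binary.PropositionalEquality as ≡

module _ {n} {G : Graph n} {S : Fin n → Set} where

  _++ʷ_ : ∀ {u v w} → WalkIn G S u v → WalkIn G S v w → WalkIn G S u w
  here _      ++ʷ q = q
  step s uv p ++ʷ q = step s uv (p ++ʷ q)

  source : ∀ {u v} → WalkIn G S u v → S u
  source (here s)     = s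
  source (step s _ _) = s

  reverseʷ : ∀ {u v} → WalkIn G S u v → WalkIn G S v u
  reverseʷ (here s)      = here s
  reverseʷ (step s uv p) = reverseʷ p ++ʷ step (source p) (sym G uv) (here s)

mapʷ : ∀ {m n} {G : Graph m} {H : Graph n} {S : Fin m → Set} {T : Fin n → Set}
       (h : Fin m → Fin n) → (∀ {u} → S u → T (h u)) →
       (∀ {u v} → Adj G u v → Adj H (h u) (h v)) →
       ∀ {u v} → WalkIn G S u v → WalkIn H T (h u) (h v)
mapʷ h hS hAdj (here s)      = here (hS s)
mapʷ h hS hAdj (step s uv p) = step (hS s) (hAdj uv) (mapʷ h hS hAdj p)

module _ {n} (H : Graph n) (x : Fin n)
  (linked : ∀ {a b} → Adj H x a → Adj H x b → ReachableAvoiding H x a b) where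

  -- A walk through x leaves and re-enters G - x at neighbours of x, which `linked` joins.
  mutual
    avoid : ∀ {u v} → Reachable H u v → u ≢ x → v ≢ x → ReachableAvoiding H x u v
    avoid (here _) u≢x _ = here u≢x
    avoid (step {v = y} _ uy p) u≢x v≢x with y ≟ x
    ... | yes refl = detour (sym H uy) p v≢x
    ... | no y≢x   = step u≢x uy (avoid p y≢x v≢x)

    detour : ∀ {a v} → Adj H x a → Reachable H x v → v ≢ x → ReachableAvoiding H x a v
    detour _ (here _) x≢x = ⊥-elim (x≢x refl)
    detour xa (step {v = y} _ xy p) v≢x with y ≟ x
    ... | yes refl = ⊥-elim (irrefl H xy)
    ... | no y≢x   = linked xa xy ++ʷ avoid p y≢x v≢x

  linked-neighbours⇒¬IsCutVertex : ¬ IsCutVertex H x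
  linked-neighbours⇒¬IsCutVertex (_ , _ , u≢x , v≢x , p , ¬q) = ¬q (avoid p u≢x v≢x)

least : ∀ {n} {P : Fin n → Set} → (∀ i → Dec (P i)) →
        ∀ {i} → P i → ∃[ p ] (P p × (∀ {k} → P k → p ≤ k))
least {suc n} P? Pi with P? zero
least {suc n} P? _          | yes P0 = zero , P0 , λ _ → z≤n
least {suc n} P? {zero}  P0 | no ¬P0 = ⊥-elim (¬P0 P0)
least {suc n} P? {suc i} Pi | no ¬P0 with least (P? ∘ suc) Pi
... | p , Pp , p≤ = suc p , Pp , λ { {zero} P0 → ⊥-elim (¬P0 P0) ; {suc k} Pk → s≤s (p≤ Pk) }

greatest : ∀ {n} {P : Fin n → Set} → (∀ i → Dec (P i)) →
           ∀ {i} → P i → ∃[ q ] (P q × (∀ {k} → P k → k ≤ q))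
greatest {suc n} P? Pi with any? (P? ∘ suc)
greatest {suc n} P? _          | yes (j , Pj) with greatest (P? ∘ suc) Pj
... | q , Pq , ≤q = suc q , Pq , λ { {zero} _ → z≤n ; {suc k} Pk → s≤s (≤q Pk) }
greatest {suc n} P? {zero}  P0 | no ¬P∘suc =
  zero , P0 , λ { {zero} _ → z≤n ; {suc k} Pk → ⊥-elim (¬P∘suc (k , Pk)) }
greatest {suc n} P? {suc i} Pi | no ¬P∘suc = ⊥-elim (¬P∘suc (i , Pi))

first-or-last : ∀ {n} (α : Fin n) → (∀ {i k : Fin n} → i < α → α < k → ⊥) →
                (toℕ α ≡ 0) ⊎ (suc (toℕ α) ≡ n)
first-or-last {suc m} zero        _          = inj₁ refl
first-or-last {suc m} α@(suc _) noInterior with <-cmp α (fromℕ m)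
... | tri< α<last _ _ = ⊥-elim (noInterior {i = zero} (s≤s z≤n) α<last)
... | tri≈ _ α≡last _ = inj₂ (cong suc (≡.trans (cong toℕ α≡last) (toℕ-fromℕ m)))
... | tri> _ _ last<α = ⊥-elim (ℕ.<⇒≱ last<α (≤fromℕ α))

AdjacentToAllBut : ∀ {n} → Graph n → Fin n → Fin n → Set
AdjacentToAllBut G x w = ∀ u → u ≢ x → u ≢ w → Adj G w u

adjacentToAllBut? : ∀ {n} (G : Graph n) x w → Dec (AdjacentToAllBut G x w)
adjacentToAllBut? G x w = all? (λ u → ¬? (u ≟ x) →-dec (¬? (u ≟ w) →-dec adj? G w u))

¬AdjacentToAllBut⇒coneighbour : ∀ {n} {G : Graph n} {x w} → ¬ AdjacentToAllBut G x w →
                                ∃[ u ] (u ≢ x × Adj (complement G) w u)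
¬AdjacentToAllBut⇒coneighbour {n} {G} {x} {w} ¬all
  with ¬∀⟶∃¬ n _ (λ u → ¬? (u ≟ x) →-dec (¬? (u ≟ w) →-dec adj? G w u)) ¬all
... | u , ¬adj = u , (λ u≡x → ¬adj λ u≢x → ⊥-elim (u≢x u≡x))
                   , (λ w≡u → ¬adj λ _ u≢w → ⊥-elim (u≢w (≡.sym w≡u)))
                   , (λ wu → ¬adj λ _ _ → wu)

IsStraight : ∀ {n} → Graph n → Set
IsStraight G = ∀ i j k → i < j → j < k → Adj G i k → Adj G i j × Adj G j k

-- IsStraightEnumeration G e unfolds to IsStraight (pullback (Inverse.to e) G).
pullback : ∀ {m n} → (Fin m → Fin n) → Graph n → Graph m
pullback h G = record
  { Adj    = λ u v → Adj G (h u) (h v)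
  ; adj?   = λ u v → adj? G (h u) (h v)
  ; sym    = sym G
  ; irrefl = irrefl G
  }

module Straight {n} {G : Graph n} (straight : IsStraight G) where

  Ḡ : Graph n
  Ḡ = complement G

  adj-inwardˡ : ∀ {i j k : Fin n} → i ≤ j → j < k → Adj G i k → Adj G j k
  adj-inwardˡ {i} {j} {k} i≤j j<k ik with i ≟ j
  ... | yes refl = ik
  ... | no i≢j   = proj₂ (straight i j k (≤∧≢⇒< i≤j i≢j) j<k ik)

  adj-inwardʳ : ∀ {i j k : Fin n} → i < j → j ≤ k → Adj G i k → Adj G i j
  adj-inwardʳ {i} {j} {k} i<j j≤k ik with j ≟ k
  ... | yes refl = ik
  ... | no j≢k   = proj₁ (straight i j k i<j (≤∧≢⇒< j≤k j≢k) ik)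

  coadj-outwardˡ : ∀ {i j k : Fin n} → i ≤ j → j < k → Adj Ḡ j k → Adj Ḡ i k
  coadj-outwardˡ i≤j j<k (_ , ¬jk) = <⇒≢ (ℕ.≤-<-trans i≤j j<k) , ¬jk ∘ adj-inwardˡ i≤j j<k

  coadj-outwardʳ : ∀ {i j k : Fin n} → i < j → j ≤ k → Adj Ḡ i j → Adj Ḡ i k
  coadj-outwardʳ i<j j≤k (_ , ¬ij) = <⇒≢ (ℕ.<-≤-trans i<j j≤k) , ¬ij ∘ adj-inwardʳ i<j j≤k

  interior⇒¬IsCutVertex : ∀ {i α k : Fin n} → i < α → α < k → ¬ IsCutVertex Ḡ α
  interior⇒¬IsCutVertex {i} {α} {k} i<α α<k = linked-neighbours⇒¬IsCutVertex Ḡ α linked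
    where
    to-k : ∀ {a} → a < α → Adj Ḡ α a → Adj Ḡ a k
    to-k a<α αa = coadj-outwardʳ a<α (ℕ.<⇒≤ α<k) (sym Ḡ αa)

    to-i : ∀ {a} → α < a → Adj Ḡ α a → Adj Ḡ i a
    to-i α<a αa = coadj-outwardˡ (ℕ.<⇒≤ i<α) α<a αa

    across : ∀ {a b} → a < α → α < b → Adj Ḡ α a → Adj Ḡ a b
    across a<α α<b αa = coadj-outwardʳ a<α (ℕ.<⇒≤ α<b) (sym Ḡ αa)

    linked : ∀ {a b} → Adj Ḡ α a → Adj Ḡ α b → ReachableAvoiding Ḡ α a b
    linked {a} {b} αa αb with <-cmp a α | <-cmp b α
    ... | tri≈ _ a≡α _ | _            = ⊥-elim (proj₁ αa (≡.sym a≡α))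
    ... | _            | tri≈ _ b≡α _ = ⊥-elim (proj₁ αb (≡.sym b≡α))
    ... | tri< a<α _ _ | tri< b<α _ _ =
      step (<⇒≢ a<α) (to-k a<α αa)
        (step (≢-sym (<⇒≢ α<k)) (sym Ḡ (to-k b<α αb)) (here (<⇒≢ b<α)))
    ... | tri> _ _ α<a | tri> _ _ α<b =
      step (≢-sym (<⇒≢ α<a)) (sym Ḡ (to-i α<a αa))
        (step (<⇒≢ i<α) (to-i α<b αb) (here (≢-sym (<⇒≢ α<b))))
    ... | tri< a<α _ _ | tri> _ _ α<b =
      step (<⇒≢ a<α) (across a<α α<b αa) (here (≢-sym (<⇒≢ α<b)))
    ... | tri> _ _ α<a | tri< b<α _ _ =
      step (≢-sym (<⇒≢ α<a)) (sym Ḡ (across b<α α<a αb)) (here (<⇒≢ b<α))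

  module _ {α p q : Fin n} (p≢α : p ≢ α) (q≢α : q ≢ α)
           (p-least : ∀ {k} → k ≢ α → p ≤ k) (q-greatest : ∀ {k} → k ≢ α → k ≤ q)
           (noneAdjacentToAll : ∀ {w} → w ≢ α → ¬ AdjacentToAllBut G α w) where

    coadj-extremes : Adj Ḡ p q
    coadj-extremes = p≢q , ¬pq
      where
      p≢q : p ≢ q
      p≢q p≡q = noneAdjacentToAll p≢α λ u u≢α u≢p → ⊥-elim (u≢p
        (≤-antisym (subst (u ≤_) (≡.sym p≡q) (q-greatest u≢α)) (p-least u≢α)))
      ¬pq : ¬ Adj G p q
      ¬pq pq = noneAdjacentToAll p≢α λ u u≢α u≢p →
        adj-inwardʳ (≤∧≢⇒< (p-least u≢α) (≢-sym u≢p)) (q-greatest u≢α) pq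

    coadj-extreme : ∀ {i} → i ≢ α → Adj Ḡ p i ⊎ Adj Ḡ i q
    coadj-extreme {i} i≢α with ¬AdjacentToAllBut⇒coneighbour {G = G} (noneAdjacentToAll i≢α)
    ... | k , k≢α , ik with <-cmp k i
    ...   | tri< k<i _ _ = inj₁ (coadj-outwardˡ (p-least k≢α) k<i (sym Ḡ ik))
    ...   | tri≈ _ k≡i _ = ⊥-elim (proj₁ ik (≡.sym k≡i))
    ...   | tri> _ _ i<k = inj₂ (coadj-outwardʳ i<k (q-greatest k≢α) ik)

    reach-least : ∀ {i} → i ≢ α → ReachableAvoiding Ḡ α i p
    reach-least i≢α with coadj-extreme i≢α
    ... | inj₁ pi = step i≢α (sym Ḡ pi) (here p≢α)
    ... | inj₂ iq = step i≢α iq (step q≢α (sym Ḡ coadj-extremes) (here p≢α))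

  ¬AdjacentToAllBut⇒linked : ∀ {α} → (∀ {w} → w ≢ α → ¬ AdjacentToAllBut G α w) →
                             ∀ {a b} → a ≢ α → b ≢ α → ReachableAvoiding Ḡ α a b
  ¬AdjacentToAllBut⇒linked {α} none a≢α b≢α
    with least (λ k → ¬? (k ≟ α)) a≢α | greatest (λ k → ¬? (k ≟ α)) a≢α
  ... | p , p≢α , p-least | q , q≢α , q-greatest =
    to-p a≢α ++ʷ reverseʷ (to-p b≢α)
    where
    to-p : ∀ {i} → i ≢ α → ReachableAvoiding Ḡ α i p
    to-p = reach-least p≢α q≢α p-least q-greatest none

  IsCutVertex⇒AdjacentToAllBut : ∀ {α} → IsCutVertex Ḡ α →
                                 ∃[ w ] (w ≢ α × AdjacentToAllBut G α w)
  IsCutVertex⇒AdjacentToAllBut {α} (_ , _ , u≢α , v≢α , _ , ¬linked)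
    with any? (λ w → ¬? (w ≟ α) ×-dec adjacentToAllBut? G α w)
  ... | yes found = found
  ... | no none   =
    ⊥-elim (¬linked (¬AdjacentToAllBut⇒linked (λ w≢α all → none (_ , w≢α , all)) u≢α v≢α))

module _ {m n} {G : Graph n} (e : Fin m ↔ Fin n) where
  open Inverse e

  to-injective : ∀ {a b} → to a ≡ to b → a ≡ b
  to-injective = Injection.injective (↔⇒↣ e)

  from-injective : ∀ {a b} → from a ≡ from b → a ≡ b
  from-injective = Injection.injective (↔⇒↣ (↔-sym e))

  from-≢ : ∀ {u x} → u ≢ to x → from u ≢ x
  from-≢ {u} u≢x from-u≡x = u≢x (≡.trans (≡.sym (strictlyInverseˡ u)) (cong to from-u≡x))

  IsCutVertex-complement-pullback : ∀ {x} → IsCutVertex (complement G) (to x) →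
                                    IsCutVertex (complement (pullback to G)) x
  IsCutVertex-complement-pullback {x} (u , v , u≢x , v≢x , p , ¬q) =
    from u , from v , from-≢ u≢x , from-≢ v≢x , mapʷ from (λ _ → tt) coadj-from p ,
    λ q → ¬q (subst₂ (ReachableAvoiding (complement G) (to x))
                     (strictlyInverseˡ u) (strictlyInverseˡ v)
                     (mapʷ to (_∘ to-injective) coadj-to q))
    where
    coadj-from : ∀ {a b} → Adj (complement G) a b →
                 Adj (complement (pullback to G)) (from a) (from b)
    coadj-from {a} {b} (a≢b , ¬ab) =
      a≢b ∘ from-injective , ¬ab ∘ subst₂ (Adj G) (strictlyInverseˡ a) (strictlyInverseˡ b)
    coadj-to : ∀ {a b} → Adj (complement (pullback to G)) a b → Adj (complement G) (to a) (to b)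
    coadj-to (a≢b , ¬ab) = a≢b ∘ to-injective , ¬ab

  ∃AdjacentToAllBut-pullback : ∀ {x} → ∃[ w ] (w ≢ x × AdjacentToAllBut (pullback to G) x w) →
                              ∃[ w ] (w ≢ to x × AdjacentToAllBut G (to x) w)
  ∃AdjacentToAllBut-pullback (w , w≢x , all) =
    to w , w≢x ∘ to-injective ,
    λ u u≢x u≢w →
      subst (Adj G (to w)) (strictlyInverseˡ u) (all (from u) (from-≢ u≢x) (from-≢ u≢w))

proposition2p13 :
    ∀ {n} (G : Graph n) (e : Fin n ↔ Fin n) →
    Connected G → IsProperInterval G → IsStraightEnumeration G e →
    (α : Fin n) → IsCutVertex (complement G) (Inverse.to e α) →
    ((toℕ α ≡ 0) ⊎ (suc (toℕ α) ≡ n))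
    × (∃[ w ] ((w ≢ Inverse.to e α) × (∀ u → u ≢ Inverse.to e α → u ≢ w → Adj G w u)))
proposition2p13 G e _ _ straight α cut =
  first-or-last α (λ i<α α<k → interior⇒¬IsCutVertex i<α α<k cut′) ,
  ∃AdjacentToAllBut-pullback {G = G} e (IsCutVertex⇒AdjacentToAllBut cut′)
  where
  open Straight {G = pullback (Inverse.to e) G} straight
  cut′ : IsCutVertex Ḡ α
  cut′ = IsCutVertex-complement-pullback e cut
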